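{- For a given existential PBES, if there exist proof graphs (with $r=\mathrm{true}$) of $X(\vec v)$, then one of them is obtained from its dependency space by removing some $\vee$/$\wedge$-vertices and collapsing each $\wedge$-vertex $(i,k,\vec v,\vec w)$ into the vertex $X_i(\vec v)$.
   Context: An existential PBES is assumed of the form $\sigma_i X_i(\vec d{:}\vec D)=\bigvee_{1\le k\le m_i}\exists \vec e{:}\vec D\ \varphi_{ik}(\vec d,\vec e)\wedge X_{a_{ik1}}(\vec f_{ik1}(\vec d,\vec e))\wedge\dots\wedge X_{a_{ikp_{ik}}}(\vec f_{ikp_{ik}}(\vec d,\vec e))$, $\sigma_i\in\{\mu,\nu\}$. The rank of $X_i$ is the number of alternations of $\mu$ and $\nu$ in $\nu\sigma_1\cdots\sigma_n$; $\mathrm{sig}(\mathcal{E})=\{X_i(\vec v)\mid \vec v\in\mathbb{D}^*\}$. A proof graph $\langle V,\to,r\rangle$ with $V\subseteq\mathrm{sig}(\mathcal{E})$, $r\in\{\mathrm{true},\mathrm{false}\}$ satisfies: (1) for every $X_i(\vec v)\in V$, $\varphi_i(\vec v)$ evaluates to $r$ when the signatures in the postset of $X_i(\vec v)$ are assumed $r$ and all others $\neg r$; (2) on every infinite path, the minimum rank among predicate variables occurring infinitely often is even. It proves $X(\vec v)=r$ iff $X(\vec v)\in V$. The dependency space has $\vee$-vertices $X_i(\vec v)$ and $\wedge$-vertices $(i,k,\vec v,\vec w)$, with edges $X_i(\vec v)\to(i,k,\vec v,\vec w)$ and $(i,k,\vec v,\vec w)\to X_{a_{ikj}}(\vec f_{ikj}(\vec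 v,\vec w))$ ($1\le j\le p_{ik}$) whenever $\varphi_{ik}(\vec v,\vec w)$ holds. -}

module Defs where

open import Data.Nat using (ℕ; zero; suc; _+_; _≤_; _%_)
open import Data.Fin using (Fin; zero; suc; inject₁)
open import Data.List using (List)
open import Data.Bool using (Bool; true; false)
open import Data.Product using (Σ; ∃; _×_; _,_; proj₁; proj₂)
open import Relation.Nullary using (¬_)
open import Relation.Binary.PropositionalEquality using (_≡_)
open import Function using (_⇔_)

data Fix : Set where
  μ ν : Fix

alt : Fix → Fix → ℕ
alt μ μ = 0
alt ν ν = 0
alt μ ν = 1
alt ν μ = 1

-- rank' prev s i : alternations in the word  prev s(0) s(1) ⋯ s(i)
rank' : Fix → ∀ {n'} → (Fin n' → Fix) → Fin n' → ℕ
rank' prev s zero = alt prev (s zero)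
rank' prev s (suc i) = alt prev (s zero) + rank' (s zero) (λ j → s (suc j)) i

-- Parameter vectors and
-- existential witnesses are elements of 𝔻* (= List 𝔻); sorts can be
-- enforced inside the conditions φ.
--   σ_i X_i(d) = ⋁_{k < m_i} ∃ e. φ_ik(d,e) ∧ ⋀_{j < p_ik} X_{a_ikj}(f_ikj(d,e))
record PBES (𝔻 : Set) : Set₁ where
  field
    n : ℕ
    σ : Fin n → Fix
    m : Fin n → ℕ
    φ : (i : Fin n) → Fin (m i) → List 𝔻 → List 𝔻 → Set
    p : (i : Fin n) → Fin (m i) → ℕ
    a : (i : Fin n) (k : Fin (m i)) → Fin (p i k) → Fin n
    f : (i : Fin n) (k : Fin (m i)) → Fin (p i k) → List 𝔻 → List 𝔻 → List 𝔻

  Sig : Set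
  Sig = Fin n × List 𝔻

  rank : Fin n → ℕ
  rank = rank' ν σ

record Graph {𝔻 : Set} (E : PBES 𝔻) : Set₁ where
  open PBES E
  field
    V : Sig → Set
    _⟶_ : Sig → Sig → Set
    edge-src : ∀ {s t} → s ⟶ t → V s
    edge-tgt : ∀ {s t} → s ⟶ t → V t

module _ {𝔻 : Set} (E : PBES 𝔻) where
  open PBES E

  InfinitelyOften : (ℕ → Sig) → Fin n → Set
  InfinitelyOften π i = ∀ N → ∃ λ t → N ≤ t × proj₁ (π t) ≡ i

  Even : ℕ → Set
  Even k = k % 2 ≡ 0

  -- the value Y gets under the assignment "postset ↦ r, others ↦ ¬r",
  -- expressed as "Y is true"
  IsTrueUnder : (r : Bool) → (G : Graph E) → Sig → Sig → Set
  IsTrueUnder true  G s Y = Graph._⟶_ G s Y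
  IsTrueUnder false G s Y = ¬ Graph._⟶_ G s Y

  φ-true : (r : Bool) → (G : Graph E) → Fin n → List 𝔻 → Set
  φ-true r G i v = Σ (Fin (m i)) λ k → Σ (List 𝔻) λ e →
    φ i k v e × (∀ j → IsTrueUnder r G (i , v) (a i k j , f i k j v e))

  EvaluatesTo : Bool → Set → Set
  EvaluatesTo true  P = P
  EvaluatesTo false P = ¬ P

  record IsProofGraph (G : Graph E) (r : Bool) : Set₁ where
    open Graph G
    field
      local : ∀ i v → V (i , v) → EvaluatesTo r (φ-true r G i v)
      paths : (π : ℕ → Sig) → (∀ t → π t ⟶ π (suc t)) →
              Σ (Fin n) λ i → InfinitelyOften π i × Even (rank i) ×
                (∀ j → InfinitelyOften π j → rank i ≤ rank j)

  -- G is obtained from the dependency space by removing some ∨-vertices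
  -- (those not in V) and some ∧-vertices (those not in W) and collapsing
  -- each remaining ∧-vertex (i,k,v,w) into X_i(v).
  ObtainedFromDependencySpace : Graph E → Set₁
  ObtainedFromDependencySpace G =
    Σ ((i : Fin n) → Fin (m i) → List 𝔻 → List 𝔻 → Set) λ W →
      (∀ i k v w → W i k v w → φ i k v w × V (i , v)) ×
      (∀ s t → (s ⟶ t) ⇔
        (Σ (Fin (m (proj₁ s))) λ k → Σ (List 𝔻) λ w →
           W (proj₁ s) k (proj₂ s) w ×
           Σ (Fin (p (proj₁ s) k)) λ j →
             ((a (proj₁ s) k j , f (proj₁ s) k j (proj₂ s) w) ≡ t) × V t))
    where open Graph G

-- Keep from a true proof graph G only the ∧-vertices (i,k,v,w) whose conjuncts are all
-- edges of G, and collapse them. The result is a subgraph of G, so every infinite path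
-- in it is one of G and the parity condition is inherited; and the disjunct witnessing
-- φ_i(v) in G survives with all its edges, so the local condition still holds.
module Submission where

open import Defs
open import Data.Fin using (Fin)
open import Data.Bool using (true)
open import Data.List using (List)
open import Data.Nat using (ℕ; suc; _≤_)
open import Data.Product using (Σ; _×_; _,_; proj₂)
open import Relation.Binary.PropositionalEquality using (_≡_; refl)
open import Function using (mk⇔; id)

module _ {𝔻 : Set} (E : PBES 𝔻) where
  open PBES E

  AndVertices : Set₁
  AndVertices = (i : Fin n) → Fin (m i) → List 𝔻 → List 𝔻 → Set

  DependencyEdge : (Sig → Set) → AndVertices → Sig → Sig → Set
  DependencyEdge V W (i , v) t =
    Σ (Fin (m i)) λ k → Σ (List 𝔻) λ w → W i k v w ×
      Σ (Fin (p i k)) λ j → ((a i k j , f i k j v w) ≡ t) × V t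

  collapse : (V : Sig → Set) (W : AndVertices) →
             (∀ i k v w → W i k v w → φ i k v w × V (i , v)) → Graph E
  collapse V W sound = record
    { V        = V
    ; _⟶_      = DependencyEdge V W
    ; edge-src = λ { {i , v} (k , w , Wkw , _) → proj₂ (sound i k v w Wkw) }
    ; edge-tgt = λ { (_ , _ , _ , _ , _ , Vt) → Vt }
    }

  collapse-obtained : ∀ V W sound →
                      ObtainedFromDependencySpace E (collapse V W sound)
  collapse-obtained V W sound = W , sound , λ _ _ → mk⇔ id id

  ParityCondition : Graph E → Set
  ParityCondition G = (π : ℕ → Sig) → (∀ t → Graph._⟶_ G (π t) (π (suc t))) →
    Σ (Fin n) λ i → InfinitelyOften E π i × Even E (rank i) ×
      (∀ j → InfinitelyOften E π j → rank i ≤ rank j)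

  parity-⊆ : ∀ {G H : Graph E} →
             (∀ {s t} → Graph._⟶_ H s t → Graph._⟶_ G s t) →
             ParityCondition G → ParityCondition H
  parity-⊆ H⊆G parityG π steps = parityG π (λ t → H⊆G (steps t))

  module _ (G : Graph E) where
    open Graph G

    witnessed : AndVertices
    witnessed i k v w =
      V (i , v) × φ i k v w × (∀ j → (i , v) ⟶ (a i k j , f i k j v w))

    witnessed-sound : ∀ i k v w → witnessed i k v w → φ i k v w × V (i , v)
    witnessed-sound i k v w (Vv , φkw , _) = φkw , Vv

    witnessed-graph : Graph E
    witnessed-graph = collapse V witnessed witnessed-sound

    witnessed-⊆ : ∀ {s t} → Graph._⟶_ witnessed-graph s t → s ⟶ t
    witnessed-⊆ {s} (_ , _ , (_ , _ , edges) , j , refl , _) = edges j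

    witnessed-proof-graph : IsProofGraph E G true →
                            IsProofGraph E witnessed-graph true
    witnessed-proof-graph pg = record
      { local = λ i v Vv →
          let (k , w , φkw , edges) = IsProofGraph.local pg i v Vv in
          k , w , φkw ,
          λ j → k , w , (Vv , φkw , edges) , j , refl , edge-tgt (edges j)
      ; paths = parity-⊆ {G} {witnessed-graph} witnessed-⊆ (IsProofGraph.paths pg)
      }

lemma1 : {𝔻 : Set} (E : PBES 𝔻) (i : Fin (PBES.n E)) (v : List 𝔻) →
    Σ (Graph E) (λ G → IsProofGraph E G true × Graph.V G (i , v)) →
    Σ (Graph E) (λ G → IsProofGraph E G true × Graph.V G (i , v) ×
    ObtainedFromDependencySpace E G)
lemma1 E i v (G , pg , Vv) =
  witnessed-graph E G , witnessed-proof-graph E G pg , Vv ,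
  collapse-obtained E (Graph.V G) (witnessed E G) (witnessed-sound E G)
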